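{- Let $H$ be a hypergraph, and let $\mathcal{E}(H)$ denote the number of edges of $H$ that are not singleton, empty, or duplicate edges. Then $|V(H)|-\mathcal{E}(H)\leq b_L(H)$.
   Context: A hypergraph $H$ consists of a nonempty finite vertex set $V(H)$ and a finite family $E(H)$ of edges, each edge a subset of $V(H)$; distinct edges with the same vertex set (parallel edges) are permitted. For the count $\mathcal{E}(H)$, among each class of parallel edges one is regarded as the original and the others as duplicates, so each class of parallel edges of size at least two contributes exactly $1$. Lazy burning: a set $S\subseteq V(H)$ is set on fire; then repeatedly, any unburned vertex $v$ that lies in an edge $e$ with $|e|\geq 2$ such that every vertex of $e\setminus\{v\}$ is on fire catches fire. $S$ is a lazy burning set if eventually every vertex is on fire. The lazy burning number $b_L(H)$ is the minimum size of a lazy burning set. -}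

module Defs where

open import Data.Nat using (ℕ; suc; _≤_)
open import Data.Bool using (Bool)
import Data.Bool as B
open import Data.Fin using (Fin)
open import Data.Fin.Subset using (Subset; _∈_; ∣_∣)
open import Data.Vec.Properties using (≡-dec)
open import Data.List using (List; length; filter; deduplicate)
import Data.List.Membership.Propositional as LM
open import Data.Nat using (_≤?_)
open import Relation.Nullary using (Dec)
open import Data.Product using (Σ; _×_)
open import Relation.Binary.PropositionalEquality using (_≡_; _≢_)

-- A hypergraph on the vertex set Fin n (nonempty: n = suc m is required
-- by the definitions below).  Edges form a list, so parallel edges allowed.
record Hypergraph : Set where
  field
    m     : ℕ
    edges : List (Subset (suc m))

  nV : ℕ
  nV = suc m

open Hypergraph public

_≟E_ : ∀ {n} (x y : Subset n) → Dec (x ≡ y)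
_≟E_ = ≡-dec B._≟_

𝓔 : Hypergraph → ℕ
𝓔 H = length (deduplicate _≟E_ (filter (λ e → 2 ≤? ∣ e ∣) (edges H)))

-- Vertices eventually on fire when S is set on fire (least closure of the
-- lazy burning propagation rule).
data Burned (H : Hypergraph) (S : Subset (nV H)) : Fin (nV H) → Set where
  init   : ∀ {v} → v ∈ S → Burned H S v
  spread : ∀ {v} (e : Subset (nV H)) → e LM.∈ edges H → 2 ≤ ∣ e ∣ → v ∈ e →
           (∀ u → u ∈ e → u ≢ v → Burned H S u) → Burned H S v

IsLazyBurningSet : (H : Hypergraph) → Subset (nV H) → Set
IsLazyBurningSet H S = ∀ v → Burned H S v

IsLazyBurningNumber : Hypergraph → ℕ → Set
IsLazyBurningNumber H k =
  Σ (Subset (nV H)) (λ S → IsLazyBurningSet H S × ∣ S ∣ ≡ k)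
  × (∀ S → IsLazyBurningSet H S → k ≤ ∣ S ∣)

-- If S is not everything, follow an unburned vertex back through
-- the derivation of its burning until reaching an edge e that fires from S alone, at a vertex w.
-- Deleting every copy of e and adding w to S gives a lazy burning set of the smaller hypergraph:
-- S grows by at most one vertex while at least one counted edge class disappears.
module Submission where

open import Defs
open import Data.Nat using (ℕ; _≤_; _<_; _∸_; _+_; suc; z≤n; s≤s; _≤?_)
open import Data.Nat.Properties
  using (≤-trans; ≤-reflexive; m≤n+m; n≤1+n; +-suc; +-comm; +-monoʳ-≤; +-monoˡ-≤; m≤n+o⇒m∸n≤o; module ≤-Reasoning)
open import Data.Nat.Induction using (<-wellFounded)
open import Data.Bool using (true; false)
open import Data.Fin using (Fin) renaming (_≟_ to _≟ᶠ_)
open import Data.Fin.Properties using (any?; all?; ¬∀⟶∃¬)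
open import Data.Fin.Subset using (Subset; _∈_; _∉_; ∣_∣; _∪_; ⁅_⁆; ⊤; inside; outside)
open import Data.Fin.Subset.Properties using (_∈?_; ∣⊤∣≡n; ∣⁅x⁆∣≡1; p⊆q⇒∣p∣≤∣q∣; x∈p∪q⁺; x∈⁅x⁆)
open import Data.Vec using ([]; _∷_)
open import Data.List using (List; length; filter; deduplicate)
open import Data.List.Properties using (filter-all; filter-notAll)
import Data.List.Membership.Propositional as LM
open import Data.List.Membership.Propositional.Properties using (∈-filter⁺; ∈-deduplicate⁺)
import Data.List.Relation.Unary.All as All
open import Data.List.Relation.Unary.All.Properties using (all-filter)
import Data.List.Relation.Unary.Any as Any
open import Data.Product using (_,_)
open import Data.Sum using (inj₁; inj₂)
open import Function using (_∘_)
open import Induction.WellFounded using (Acc; acc)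
open import Relation.Nullary using (¬_; yes; no; ¬?; does; contradiction)
open import Relation.Nullary.Decidable using (_×-dec_; decidable-stable)
open import Relation.Unary using (Pred; Decidable)
open import Relation.Binary.Definitions using (DecidableEquality)
open import Relation.Binary.PropositionalEquality
  using (_≡_; _≢_; refl; sym; trans; cong; subst; module ≡-Reasoning)

module _ {a p q} {A : Set a} {P : Pred A p} {Q : Pred A q} (P? : Decidable P) (Q? : Decidable Q) where

  filter-comm : ∀ xs → filter P? (filter Q? xs) ≡ filter Q? (filter P? xs)
  filter-comm List.[]       = refl
  filter-comm (x List.∷ xs) with does (P? x) in eqP | does (Q? x) in eqQ
  ... | true  | true  rewrite eqP | eqQ = cong (x List.∷_) (filter-comm xs)
  ... | true  | false rewrite eqQ = filter-comm xs
  ... | false | true  rewrite eqP = filter-comm xs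
  ... | false | false = filter-comm xs

module _ {a q} {A : Set a} (_≟_ : DecidableEquality A) {Q : Pred A q} (Q? : Decidable Q) where

  -- A predicate keeps either all copies of a value or none, so it commutes with deduplication.
  deduplicate-filter : ∀ xs → deduplicate _≟_ (filter Q? xs) ≡ filter Q? (deduplicate _≟_ xs)
  deduplicate-filter List.[]       = refl
  deduplicate-filter (x List.∷ xs) with Q? x
  ... | yes _  = cong (x List.∷_) (trans (cong (filter (¬? ∘ (x ≟_))) (deduplicate-filter xs))
                                         (filter-comm (¬? ∘ (x ≟_)) Q? (deduplicate _≟_ xs)))
  ... | no ¬qx = sym (begin
    filter Q? (filter (¬? ∘ (x ≟_)) ys)  ≡⟨ filter-comm Q? (¬? ∘ (x ≟_)) ys ⟩
    filter (¬? ∘ (x ≟_)) (filter Q? ys)  ≡⟨ filter-all (¬? ∘ (x ≟_)) (All.map Q⇒≢x (all-filter Q? ys)) ⟩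
    filter Q? ys                         ≡⟨ sym (deduplicate-filter xs) ⟩
    deduplicate _≟_ (filter Q? xs)       ∎)
    where
    open ≡-Reasoning
    ys : List A
    ys = deduplicate _≟_ xs
    Q⇒≢x : ∀ {y} → Q y → x ≢ y
    Q⇒≢x qy refl = ¬qx qy

∣p∪q∣≤∣p∣+∣q∣ : ∀ {n} (p q : Subset n) → ∣ p ∪ q ∣ ≤ ∣ p ∣ + ∣ q ∣
∣p∪q∣≤∣p∣+∣q∣ []            []            = z≤n
∣p∪q∣≤∣p∣+∣q∣ (inside  ∷ p) (inside  ∷ q) =
  s≤s (≤-trans (∣p∪q∣≤∣p∣+∣q∣ p q) (+-monoʳ-≤ ∣ p ∣ (n≤1+n ∣ q ∣)))
∣p∪q∣≤∣p∣+∣q∣ (inside  ∷ p) (outside ∷ q) = s≤s (∣p∪q∣≤∣p∣+∣q∣ p q)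
∣p∪q∣≤∣p∣+∣q∣ (outside ∷ p) (inside  ∷ q) =
  ≤-trans (s≤s (∣p∪q∣≤∣p∣+∣q∣ p q)) (≤-reflexive (sym (+-suc ∣ p ∣ ∣ q ∣)))
∣p∪q∣≤∣p∣+∣q∣ (outside ∷ p) (outside ∷ q) = ∣p∪q∣≤∣p∣+∣q∣ p q

∣p∪⁅x⁆∣≤1+∣p∣ : ∀ {n} (p : Subset n) x → ∣ p ∪ ⁅ x ⁆ ∣ ≤ suc ∣ p ∣
∣p∪⁅x⁆∣≤1+∣p∣ p x = begin
  ∣ p ∪ ⁅ x ⁆ ∣      ≤⟨ ∣p∪q∣≤∣p∣+∣q∣ p ⁅ x ⁆ ⟩
  ∣ p ∣ + ∣ ⁅ x ⁆ ∣  ≡⟨ cong (∣ p ∣ +_) (∣⁅x⁆∣≡1 x) ⟩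
  ∣ p ∣ + 1          ≡⟨ +-comm ∣ p ∣ 1 ⟩
  suc ∣ p ∣          ∎
  where open ≤-Reasoning

∀∈⇒n≤∣p∣ : ∀ {n} (p : Subset n) → (∀ x → x ∈ p) → n ≤ ∣ p ∣
∀∈⇒n≤∣p∣ {n} p p-full = subst (_≤ ∣ p ∣) (∣⊤∣≡n n) (p⊆q⇒∣p∣≤∣q∣ {p = ⊤} λ {x} _ → p-full x)

deleteEdge : (H : Hypergraph) → Subset (nV H) → Hypergraph
deleteEdge H e = record { m = m H ; edges = filter (¬? ∘ (e ≟E_)) (edges H) }

module _ {H : Hypergraph} {e : Subset (nV H)} (e∈H : e LM.∈ edges H) where

  private
    ∈⇒Any¬≢ : ∀ {xs} → e LM.∈ xs → Any.Any (λ f → ¬ ¬ e ≡ f) xs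
    ∈⇒Any¬≢ = Any.map λ e≡f e≢f → e≢f e≡f

  length-deleteEdge : length (edges (deleteEdge H e)) < length (edges H)
  length-deleteEdge = filter-notAll (¬? ∘ (e ≟E_)) (edges H) (∈⇒Any¬≢ e∈H)

  𝓔-deleteEdge : 2 ≤ ∣ e ∣ → 𝓔 (deleteEdge H e) < 𝓔 H
  𝓔-deleteEdge 2≤∣e∣ = begin-strict
    𝓔 (deleteEdge H e)                                   ≡⟨ cong (length ∘ deduplicate _≟E_) (filter-comm 2≤? ≢e? (edges H)) ⟩
    length (deduplicate _≟E_ (filter ≢e? nontrivial))   ≡⟨ cong length (deduplicate-filter _≟E_ ≢e? nontrivial) ⟩
    length (filter ≢e? (deduplicate _≟E_ nontrivial))   <⟨ filter-notAll ≢e? _ (∈⇒Any¬≢ e∈distinct) ⟩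
    𝓔 H                                                  ∎
    where
    open ≤-Reasoning
    2≤? : Decidable (λ (f : Subset (nV H)) → 2 ≤ ∣ f ∣)
    2≤? f = 2 ≤? ∣ f ∣
    ≢e? : Decidable (λ f → e ≢ f)
    ≢e? = ¬? ∘ (e ≟E_)
    nontrivial : List (Subset (nV H))
    nontrivial = filter 2≤? (edges H)
    e∈distinct : e LM.∈ deduplicate _≟E_ nontrivial
    e∈distinct = ∈-deduplicate⁺ _≟E_ (∈-filter⁺ 2≤? e∈H 2≤∣e∣)

record Firing (H : Hypergraph) (S : Subset (nV H)) : Set where
  field
    edge     : Subset (nV H)
    edge∈H   : edge LM.∈ edges H
    2≤∣edge∣ : 2 ≤ ∣ edge ∣
    vertex   : Fin (nV H)
    rest∈S   : ∀ u → u ∈ edge → u ≢ vertex → u ∈ S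

module _ {H : Hypergraph} {S : Subset (nV H)} where

  burned∉⇒firing : ∀ {v} → Burned H S v → v ∉ S → Firing H S
  burned∉⇒firing (init v∈S) v∉S = contradiction v∈S v∉S
  burned∉⇒firing {v} (spread e e∈H 2≤∣e∣ _ restBurned) _
    with any? (λ u → (u ∈? e) ×-dec ¬? (u ≟ᶠ v) ×-dec ¬? (u ∈? S))
  ... | yes (u , u∈e , u≢v , u∉S) = burned∉⇒firing (restBurned u u∈e u≢v) u∉S
  ... | no ¬unburned = record
    { edge = e ; edge∈H = e∈H ; 2≤∣edge∣ = 2≤∣e∣ ; vertex = v
    ; rest∈S = λ u u∈e u≢v → decidable-stable (u ∈? S) λ u∉S → ¬unburned (u , u∈e , u≢v , u∉S)
    }

  module _ (φ : Firing H S) where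
    open Firing φ

    burned-deleteEdge : ∀ {x} → Burned H S x → Burned (deleteEdge H edge) (S ∪ ⁅ vertex ⁆) x
    burned-deleteEdge (init x∈S) = init (x∈p∪q⁺ (inj₁ x∈S))
    burned-deleteEdge {x} (spread f f∈H 2≤∣f∣ x∈f restBurned) with edge ≟E f | x ≟ᶠ vertex
    ... | yes refl | yes refl = init (x∈p∪q⁺ (inj₂ (x∈⁅x⁆ x)))
    ... | yes refl | no x≢v   = init (x∈p∪q⁺ (inj₁ (rest∈S x x∈f x≢v)))
    ... | no edge≢f | _       = spread f (∈-filter⁺ (¬? ∘ (edge ≟E_)) f∈H edge≢f) 2≤∣f∣ x∈f
                                  λ u u∈f u≢x → burned-deleteEdge (restBurned u u∈f u≢x)

lazyBurningSet-bound′ : ∀ H S → Acc _<_ (length (edges H)) →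
                        IsLazyBurningSet H S → nV H ≤ 𝓔 H + ∣ S ∣
lazyBurningSet-bound′ H S (acc rec) burns with all? (_∈? S)
... | yes S-full = ≤-trans (∀∈⇒n≤∣p∣ S S-full) (m≤n+m ∣ S ∣ (𝓔 H))
... | no S-notFull with ¬∀⟶∃¬ (nV H) (_∈ S) (_∈? S) S-notFull
...   | v , v∉S = begin
  nV H                    ≤⟨ lazyBurningSet-bound′ H′ S′ (rec (length-deleteEdge edge∈H)) (burned-deleteEdge φ ∘ burns) ⟩
  𝓔 H′ + ∣ S′ ∣          ≤⟨ +-monoʳ-≤ (𝓔 H′) (∣p∪⁅x⁆∣≤1+∣p∣ S vertex) ⟩
  𝓔 H′ + suc ∣ S ∣       ≡⟨ +-suc (𝓔 H′) ∣ S ∣ ⟩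
  suc (𝓔 H′) + ∣ S ∣     ≤⟨ +-monoˡ-≤ ∣ S ∣ (𝓔-deleteEdge edge∈H 2≤∣edge∣) ⟩
  𝓔 H + ∣ S ∣            ∎
  where
  open ≤-Reasoning
  φ : Firing H S
  φ = burned∉⇒firing (burns v) v∉S
  open Firing φ
  H′ : Hypergraph
  H′ = deleteEdge H edge
  S′ : Subset (nV H)
  S′ = S ∪ ⁅ vertex ⁆

lazyBurningSet-bound : ∀ H S → IsLazyBurningSet H S → nV H ≤ 𝓔 H + ∣ S ∣
lazyBurningSet-bound H S = lazyBurningSet-bound′ H S (<-wellFounded (length (edges H)))

mainTheorem1 : (H : Hypergraph) (k : ℕ) → IsLazyBurningNumber H k →
                 nV H ∸ 𝓔 H ≤ k
mainTheorem1 H k ((S , burns , refl) , _) =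
  m≤n+o⇒m∸n≤o (nV H) (𝓔 H) (lazyBurningSet-bound H S burns)
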